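{- Let $\mathbb{V}$ be any vector space (finite or infinite dimensional) over the field $\mathbb{F}_2$ and $\mathcal{K}=\{+\}\cup\{f_r:r\in\mathbb{F}_2,r\neq0\}$, where $f_r(v)=r\cdot v$. Then $(\mathbb{V},\mathcal{K})$ is a Ramsey algebra.
   Context: $\mathbb{F}_2$ is the two-element field. Orderly terms $\mathrm{OT}(\mathcal{K})$: smallest collection containing $\mathcal{K}$ and $\mathrm{id}_\mathbb{V}$, closed under $f(\bar x_1,\dots,\bar x_k)=g(h_1(\bar x_1),\dots,h_k(\bar x_k))$ for $k$-ary $g\in\mathcal{K}$, orderly terms $h_i$, consecutive disjoint variable blocks $\bar x_i$. For $\vec a,\vec b\in{}^\omega\mathbb{V}$, $\vec a\le_\mathcal{K}\vec b$ means there are orderly terms $f_j$ and finite subsequences $\vec b_j$ of $\vec b$ with $\vec a(j)=f_j(\bar b_j)$ for all $j\in\omega$ and $\vec b_0\ast\vec b_1\ast\cdots$ a subsequence of $\vec b$. $\mathrm{FR}_\mathcal{K}(\vec a)=\{f(\bar\tau):f\in\mathrm{OT}(\mathcal{K}),\ \vec\tau\text{ a finite subsequence of }\vec a\}$. $(\mathbb{V},\mathcal{K})$ is a Ramsey algebra if for every $\vec b\in{}^\omega\mathbb{V}$ and $X\subseteq\mathbb{V}$ there exists $\vec a\le_\mathcal{K}\vec b$ with $\mathrm{FR}_\mathcal{K}(\vec a)\subseteq X$ or $\mathrm{FR}_\mathcal{K}(\vec a)\cap X=\varnothing$. -}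

module Defs where

open import Level using (Level; _⊔_; Setω) renaming (suc to lsuc)
open import Data.Bool using (Bool; true; false)
open import Data.Bool.Properties using (xor-∧-commutativeRing)
open import Data.Nat using (ℕ; _+_; _<_)
open import Data.Vec using (Vec; []; _∷_; take; drop; map)
open import Data.Vec.Relation.Unary.All using (All)
open import Data.Vec.Relation.Unary.Linked using (Linked)
open import Data.Product using (Σ; _×_)
open import Data.Sum using (_⊎_)
open import Relation.Nullary using (¬_)
open import Relation.Binary.PropositionalEquality using (_≢_)
open import Algebra.Module.Bundles using (Module)

-- The two-element field F₂ = ({false,true}, xor, ∧), with 0 = false, 1 = true.
F₂ = xor-∧-commutativeRing

module _ {m ℓm : Level} (V : Module F₂ m ℓm) where
  open Module V

  -- Orderly terms OT(K) for K = {+} ∪ {f_r : r ∈ F₂, r ≠ 0}, indexed by arity.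
  --   var        : the identity id_V
  --   add t u    : +(t(x̄₁), u(x̄₂)) on consecutive disjoint blocks
  --   scale r t  : f_r(t(x̄)) with f_r(v) = r · v, r ≠ 0
  data OT : ℕ → Set where
    var   : OT 1
    add   : ∀ {k l} → OT k → OT l → OT (k + l)
    scale : (r : Bool) → r ≢ false → ∀ {k} → OT k → OT k

  ⟦_⟧ : ∀ {k} → OT k → Vec Carrierᴹ k → Carrierᴹ
  ⟦ var ⟧ (x ∷ []) = x
  ⟦ add {k} t u ⟧ xs = ⟦ t ⟧ (take k xs) +ᴹ ⟦ u ⟧ (drop k xs)
  ⟦ scale r _ t ⟧ xs = r *ₗ ⟦ t ⟧ xs

  Seq : Set m
  Seq = ℕ → Carrierᴹ

  -- Strictly increasing finite index lists (a finite subsequence of a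
  -- sequence is given by such a list of positions).
  Increasing : ∀ {k} → Vec ℕ k → Set
  Increasing = Linked _<_

  Before : ∀ {k l} → Vec ℕ k → Vec ℕ l → Set
  Before I J = All (λ i → All (i <_) J) I

  -- a ≤_K b : a(j) = f_j(b̄_j) with orderly f_j, b̄_j finite subsequences of b,
  -- and b̄₀ ∗ b̄₁ ∗ ⋯ a subsequence of b.
  _≤K_ : Seq → Seq → Set ℓm
  a ≤K b =
    Σ (ℕ → ℕ) λ n →
    Σ ((j : ℕ) → OT (n j)) λ f →
    Σ ((j : ℕ) → Vec ℕ (n j)) λ I →
      ((j : ℕ) → Increasing (I j))
    × ((j : ℕ) → Before (I j) (I (Data.Nat.suc j)))
    × ((j : ℕ) → a j ≈ᴹ ⟦ f j ⟧ (map b (I j)))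

  FR⊆ : ∀ {ℓ} → Seq → (Carrierᴹ → Set ℓ) → Set ℓ
  FR⊆ a X = ∀ {k} (t : OT k) (I : Vec ℕ k) → Increasing I → X (⟦ t ⟧ (map a I))

  FR∩∅ : ∀ {ℓ} → Seq → (Carrierᴹ → Set ℓ) → Set ℓ
  FR∩∅ a X = ∀ {k} (t : OT k) (I : Vec ℕ k) → Increasing I → ¬ X (⟦ t ⟧ (map a I))

  IsSubset : ∀ {ℓ} → (Carrierᴹ → Set ℓ) → Set (m ⊔ ℓm ⊔ ℓ)
  IsSubset X = ∀ {x y} → x ≈ᴹ y → X x → X y

  IsRamseyAlgebra : Setω
  IsRamseyAlgebra =
    ∀ {ℓ} (b : Seq) (X : Carrierᴹ → Set ℓ) → IsSubset X →
      Σ Seq λ a → (a ≤K b) × (FR⊆ a X ⊎ FR∩∅ a X)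

-- Over F₂ the only nonzero scalar is 1, so every orderly term evaluates to the sum of
-- its arguments: FR_K(a) is the set FS(a) of finite sums of a, and every sum subsystem
-- of a is ≤_K-below a. The theorem thus reduces to Hindman's theorem, which holds for
-- ordered finite products in any semigroup; we follow Baumgartner's proof. Call Y large
-- for a when every sum subsystem of a has a finite sum in Y. If Y is large, a pigeonhole
-- argument over a finite initial window of a yields a finite sum x of a and a sum
-- subsystem beyond x for which Y ∩ x⁻¹Y is still large. Iterating this step once finds
-- such an x inside Y; iterating the stronger step builds a sum subsystem all of whose
-- finite sums lie in Y. If X is not large, some sum subsystem has no finite sum in X.
module Submission where

open import Defs
open import Axiom.ExcludedMiddle using (ExcludedMiddle)
open import Algebra.Module.Bundles using (Module)

open import Algebra.Bundles using (Semigroup)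
open import Axiom.DoubleNegationElimination using (em⇒dne)
open import Data.Bool using (true; false)
open import Data.Empty using (⊥-elim)
open import Data.Nat using (ℕ; zero; suc; _+_; _≤_; _<_; z≤n; s≤s; s<s⁻¹; _≤′_; ≤′-refl; ≤′-step)
open import Data.Nat.Properties
open import Data.Product using (Σ; ∃; _×_; _,_; proj₁; proj₂)
open import Data.Sum using (_⊎_; inj₁; inj₂)
open import Data.Unit.Polymorphic using (⊤; tt)
open import Data.Vec using (Vec; []; _∷_; take; drop; map)
open import Data.Vec.Relation.Unary.All as All using (All; []; _∷_)
open import Data.Vec.Relation.Unary.Linked using ([-]; _∷_)
open import Function using (_∘_; id)
open import Level using (Level; _⊔_) renaming (suc to lsuc)
open import Relation.Binary.Definitions using (_Respects_)
open import Relation.Binary.PropositionalEquality as ≡ using (_≡_; _≢_)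
open import Relation.Nullary using (¬_; yes; no)
open import Relation.Unary using (Pred; _⊆_; _∪_; _∩_; _⊢_; ∁)

module FiniteSums {c ℓ} (G : Semigroup c ℓ) where
  open Semigroup G renaming (Carrier to A)

  Sequence : Set c
  Sequence = ℕ → A

  private variable
    ℓx ℓy ℓz : Level
    a b d : Sequence
    i j p q r : ℕ
    u v w : A

  data FSIn (a : Sequence) : ℕ → ℕ → A → Set (c ⊔ ℓ) where
    single : p ≤ i → i < q → v ≈ a i → FSIn a p q v
    cons   : p ≤ i → FSIn a (suc i) q w → v ≈ a i ∙ w → FSIn a p q v

  FS : Sequence → ℕ → Pred A (c ⊔ ℓ)
  FS a p v = ∃ λ q → FSIn a p q v

  FSIn-nonempty : FSIn a p q v → p < q
  FSIn-nonempty (single p≤i i<q _) = ≤-<-trans p≤i i<q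
  FSIn-nonempty (cons p≤i w _) = ≤-<-trans p≤i (<-trans (n<1+n _) (FSIn-nonempty w))

  FSIn-resp : FSIn a p q Respects _≈_
  FSIn-resp v≈v′ (single p≤i i<q v≈) = single p≤i i<q (trans (sym v≈v′) v≈)
  FSIn-resp v≈v′ (cons p≤i w v≈) = cons p≤i w (trans (sym v≈v′) v≈)

  FSIn-widen : ∀ {p′ q′} → p′ ≤ p → q ≤ q′ → FSIn a p q v → FSIn a p′ q′ v
  FSIn-widen p′≤p q≤q′ (single p≤i i<q v≈) = single (≤-trans p′≤p p≤i) (<-≤-trans i<q q≤q′) v≈
  FSIn-widen p′≤p q≤q′ (cons p≤i w v≈) = cons (≤-trans p′≤p p≤i) (FSIn-widen ≤-refl q≤q′ w) v≈

  FSIn-∙ : FSIn a p r u → FSIn a r q w → FSIn a p q (u ∙ w)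
  FSIn-∙ (single p≤i i<r u≈) w = cons p≤i (FSIn-widen i<r ≤-refl w) (∙-congʳ u≈)
  FSIn-∙ (cons p≤i u′ u≈) w = cons p≤i (FSIn-∙ u′ w) (trans (∙-congʳ u≈) (assoc _ _ _))

  data FirstView (a : Sequence) (p q : ℕ) (v : A) : Set (c ⊔ ℓ) where
    unused   : FSIn a (suc p) q v → FirstView a p q v
    alone    : v ≈ a p → FirstView a p q v
    leading  : FSIn a (suc p) q w → v ≈ a p ∙ w → FirstView a p q v

  firstView : FSIn a p q v → FirstView a p q v
  firstView (single p≤i i<q v≈) with m≤n⇒m<n∨m≡n p≤i
  ... | inj₁ p<i = unused (single p<i i<q v≈)
  ... | inj₂ ≡.refl = alone v≈
  firstView (cons p≤i w v≈) with m≤n⇒m<n∨m≡n p≤i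
  ... | inj₁ p<i = unused (cons p<i w v≈)
  ... | inj₂ ≡.refl = leading w v≈

  data LastView (a : Sequence) (p q : ℕ) (v : A) : Set (c ⊔ ℓ) where
    unused   : FSIn a p q v → LastView a p q v
    alone    : v ≈ a q → LastView a p q v
    trailing : FSIn a p q u → v ≈ u ∙ a q → LastView a p q v

  lastView : FSIn a p (suc q) v → LastView a p q v
  lastView (single p≤i i<1+q v≈) with m<1+n⇒m<n∨m≡n i<1+q
  ... | inj₁ i<q = unused (single p≤i i<q v≈)
  ... | inj₂ ≡.refl = alone v≈
  lastView (cons p≤i w v≈) with lastView w
  ... | unused w′ = unused (cons p≤i w′ v≈)
  ... | alone w≈ =
    trailing (single p≤i (s<s⁻¹ (FSIn-nonempty w)) refl) (trans v≈ (∙-congˡ w≈))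
  ... | trailing u w≈ =
    trailing (cons p≤i u refl) (trans v≈ (trans (∙-congˡ w≈) (sym (assoc _ _ _))))

  record SumSubsystem (b a : Sequence) (p : ℕ) : Set (c ⊔ ℓ) where
    field
      cut   : ℕ → ℕ
      start : p ≤ cut 0
      block : ∀ j → FSIn a (cut j) (cut (suc j)) (b j)

    cut-mono′ : i ≤′ j → cut i ≤ cut j
    cut-mono′ ≤′-refl = ≤-refl
    cut-mono′ (≤′-step i≤j) = ≤-trans (cut-mono′ i≤j) (<⇒≤ (FSIn-nonempty (block _)))

    cut-mono : i ≤ j → cut i ≤ cut j
    cut-mono = cut-mono′ ∘ ≤⇒≤′

    transfer : FSIn b i j v → FSIn a (cut i) (cut j) v
    transfer (single i≤k k<j v≈) =
      FSIn-resp (sym v≈) (FSIn-widen (cut-mono i≤k) (cut-mono k<j) (block _))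
    transfer (cons i≤k w v≈) =
      FSIn-resp (sym v≈) (FSIn-widen (cut-mono i≤k) ≤-refl (FSIn-∙ (block _) (transfer w)))

    transfer-FS : FS b 0 ⊆ FS a p
    transfer-FS (q , w) = cut q , FSIn-widen start ≤-refl (transfer w)

  open SumSubsystem

  SumSubsystem-tail : ∀ a p → SumSubsystem (λ j → a (p + j)) a p
  SumSubsystem-tail a p = record
    { cut   = p +_
    ; start = m≤m+n p 0
    ; block = λ j → single ≤-refl (+-monoʳ-< p (n<1+n j)) refl
    }

  SumSubsystem-∘ : (σ : SumSubsystem b a q) → SumSubsystem d b p → SumSubsystem d a (cut σ p)
  SumSubsystem-∘ σ τ = record
    { cut   = cut σ ∘ cut τ
    ; start = cut-mono σ (start τ)
    ; block = transfer σ ∘ block τ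
    }

  SumSubsystem-weaken : p ≤ q → SumSubsystem d a q → SumSubsystem d a p
  SumSubsystem-weaken p≤q σ =
    record { cut = cut σ ; start = ≤-trans p≤q (start σ) ; block = block σ }

  SumSubsystem-trans : SumSubsystem b a p → SumSubsystem d b 0 → SumSubsystem d a p
  SumSubsystem-trans σ τ =
    SumSubsystem-weaken (≤-trans (start σ) (cut-mono σ z≤n)) (SumSubsystem-∘ σ τ)

  Large : Pred A ℓx → Sequence → ℕ → Set (c ⊔ ℓ ⊔ ℓx)
  Large X a p = ∀ b → SumSubsystem b a p → ∃ λ v → FS b 0 v × X v

  LargeOnSubsystem : Pred A ℓx → Sequence → ℕ → Set (c ⊔ ℓ ⊔ ℓx)
  LargeOnSubsystem X a p = ∃ λ b → SumSubsystem b a p × Large X b 0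

  module _ {X : Pred A ℓx} where

    Large-subsystem : Large X a p → SumSubsystem b a p → Large X b 0
    Large-subsystem LX σ d τ = LX d (SumSubsystem-trans σ τ)

    Large-meets : Large X a p → ∃ λ v → FS a p v × X v
    Large-meets {a = a} {p = p} LX =
      let (v , v∈ , x) = LX _ (SumSubsystem-tail a p)
      in v , transfer-FS (SumSubsystem-tail a p) v∈ , x

    Large-mono : ∀ {Y : Pred A ℓy} → X ⊆ Y → Large X a p → Large Y a p
    Large-mono X⊆Y LX b σ = let (v , v∈ , x) = LX b σ in v , v∈ , X⊆Y x

    LargeOnSubsystem-trans : SumSubsystem b a p → LargeOnSubsystem X b 0 → LargeOnSubsystem X a p
    LargeOnSubsystem-trans σ (d , τ , LX) = d , SumSubsystem-trans σ τ , LX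

  record Extension (Y : Pred A ℓy) (a : Sequence) : Set (c ⊔ ℓ ⊔ ℓy) where
    field
      {width} : ℕ
      x       : A
      x∈      : FSIn a 0 width x
      rest    : Sequence
      rest≼a  : SumSubsystem rest a width
      large   : Large (Y ∩ (x ∙_) ⊢ Y) rest 0

  module Classical (em : ∀ {ℓ} → ExcludedMiddle ℓ) where

    private
      dne : ∀ {ℓ} {P : Set ℓ} → ¬ ¬ P → P
      dne = em⇒dne em

    Avoiding : Pred A ℓx → Sequence → ℕ → Set (c ⊔ ℓ ⊔ ℓx)
    Avoiding X a p = ∃ λ b → SumSubsystem b a p × FS b 0 ⊆ ∁ X

    ¬Large⇒Avoiding : {X : Pred A ℓx} → ¬ Large X a p → Avoiding X a p
    ¬Large⇒Avoiding ¬LX = dne λ ¬avoiding → ¬LX λ b σ →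
      dne λ ¬meets → ¬avoiding (b , σ , λ {v} v∈ x → ¬meets (v , v∈ , x))

    Large-split : {X : Pred A ℓx} {Y : Pred A ℓy} {Z : Pred A ℓz} →
      Large Z a p → Z ⊆ X ∪ Y → LargeOnSubsystem X a p ⊎ LargeOnSubsystem Y a p
    Large-split {a = a} {p = p} {X = X} LZ Z⊆X∪Y with em {P = Large X a p}
    ... | yes LX = inj₁ (_ , SumSubsystem-tail a p , Large-subsystem LX (SumSubsystem-tail a p))
    ... | no ¬LX with ¬Large⇒Avoiding ¬LX
    ...   | b , σ , FS⊆∁X = inj₂ (b , σ , LY)
      where
      LY : Large _ b 0
      LY d τ with LZ d (SumSubsystem-trans σ τ)
      ... | v , v∈ , z with Z⊆X∪Y z
      ...   | inj₁ x = ⊥-elim (FS⊆∁X (transfer-FS τ v∈) x)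
      ...   | inj₂ y = v , v∈ , y

    -- A witness for y either avoids a s, is a s, or starts with a s: split Z into the
    -- three classes and recurse on the shorter window [s + 1, e).
    Large-pigeonhole : ∀ {W : A → Pred A ℓy} → (∀ {y} → (λ x → W x y) Respects _≈_) →
      ∀ L {s e} → L + s ≡ e → {Z : Pred A ℓz} → Large Z b p →
      (Z ⊆ λ y → ∃ λ x → FSIn a s e x × W x y) →
      ∃ λ x → FSIn a s e x × LargeOnSubsystem (W x) b p
    Large-pigeonhole W-resp zero ≡.refl LZ witness =
      let (_ , _ , z) = Large-meets LZ
          (_ , x∈ , _) = witness z
      in ⊥-elim (<-irrefl ≡.refl (FSIn-nonempty x∈))
    Large-pigeonhole {a = a} {W = W} W-resp (suc L) {s} {e} eq LZ witness
      with Large-split LZ classify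
      where
      classify : _ ⊆ (λ y → ∃ λ x → FSIn a (suc s) e x × W x y)
                   ∪ (W (a s) ∪ λ y → ∃ λ x → FSIn a (suc s) e x × W (a s ∙ x) y)
      classify z with witness z
      ... | x , x∈ , wxy with firstView x∈
      ...   | unused x∈′ = inj₁ (x , x∈′ , wxy)
      ...   | alone x≈ = inj₂ (inj₁ (W-resp x≈ wxy))
      ...   | leading w∈ x≈ = inj₂ (inj₂ (_ , w∈ , W-resp x≈ wxy))
    ... | inj₁ (b₁ , σ₁ , L₁) =
      let (x , x∈ , large) = Large-pigeonhole W-resp L (≡.trans (+-suc L s) eq) L₁ id
      in x , FSIn-widen (n≤1+n s) ≤-refl x∈ , LargeOnSubsystem-trans σ₁ large
    ... | inj₂ (b₁ , σ₁ , L₁) with Large-split L₁ id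
    ...   | inj₁ (b₂ , σ₂ , L₂) =
      a s , single ≤-refl s<e refl , b₂ , SumSubsystem-trans σ₁ σ₂ , L₂
      where
      s<e : s < e
      s<e = ≡.subst (s <_) eq (s≤s (m≤n+m s L))
    ...   | inj₂ (b₂ , σ₂ , L₂) =
      let (x , x∈ , large) = Large-pigeonhole (W-resp ∘ ∙-congˡ) L (≡.trans (+-suc L s) eq) L₂ id
      in a s ∙ x , cons ≤-refl x∈ refl ,
         LargeOnSubsystem-trans (SumSubsystem-trans σ₁ σ₂) large

    Catching : Pred A ℓy → Sequence → ℕ → Set (c ⊔ ℓ ⊔ ℓy)
    Catching Y a n = FS a n ⊆ λ y → ∃ λ x → FSIn a 0 n x × Y (x ∙ y)

    record Escape (Y : Pred A ℓy) (a : Sequence) (n : ℕ) : Set (c ⊔ ℓ ⊔ ℓy) where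
      field
        {end}    : ℕ
        element  : A
        element∈ : FSIn a n end element
        escapes  : ∀ {x} → FSIn a 0 n x → ¬ Y (x ∙ element)

    ¬Catching⇒Escape : {Y : Pred A ℓy} → ∀ {n} → ¬ Catching Y a n → Escape Y a n
    ¬Catching⇒Escape ¬catching = dne λ ¬escape → ¬catching λ (_ , y∈) → dne λ ¬catch →
      ¬escape (record { element∈ = y∈ ; escapes = λ x∈ xy → ¬catch (_ , x∈ , xy) })

    module _ {Y : Pred A ℓy} (Y-resp : Y Respects _≈_) (escape : ∀ n → Escape Y a n) where
      open Escape

      private
        double : ℕ → ℕ
        double zero = zero
        double (suc n) = suc (suc (double n))

        mark : ℕ → ℕ
        mark zero = 0
        mark (suc j) = end (escape (mark j))

        e : Sequence
        e j = element (escape (mark j))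

        e-block : ∀ j → FSIn a (mark j) (mark (suc j)) (e j)
        e-block j = element∈ (escape (mark j))

        pairs : Sequence
        pairs j = e (double j) ∙ e (suc (double j))

        pairs≼a : SumSubsystem pairs a 0
        pairs≼a = record
          { cut   = mark ∘ double
          ; start = z≤n
          ; block = λ j → FSIn-∙ (e-block (double j)) (e-block (suc (double j)))
          }

        -- Every finite sum of pairs ends in e (2n) ∙ e (2n + 1) with something before
        -- e (2n + 1), which the escape property of e (2n + 1) keeps out of Y.
        FS-pairs⊆∁Y : ∀ {n v} → FSIn pairs 0 n v → ¬ Y v
        FS-pairs⊆∁Y {zero} v∈ = ⊥-elim (<-irrefl ≡.refl (FSIn-nonempty v∈))
        FS-pairs⊆∁Y {suc n} v∈ with lastView v∈
        ... | unused v∈′ = FS-pairs⊆∁Y v∈′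
        ... | alone v≈ =
          escapes (escape _) (FSIn-widen z≤n ≤-refl (e-block (double n))) ∘ Y-resp v≈
        ... | trailing u∈ v≈ =
          escapes (escape _) (FSIn-∙ (transfer pairs≼a u∈) (e-block (double n)))
          ∘ Y-resp (trans v≈ (sym (assoc _ _ _)))

      escapes⇒¬Large : ¬ Large Y a 0
      escapes⇒¬Large LY = let (_ , (_ , v∈) , y) = LY pairs pairs≼a in FS-pairs⊆∁Y v∈ y

    Large⇒Catching : {Y : Pred A ℓy} → Y Respects _≈_ → Large Y a 0 → ∃ (Catching Y a)
    Large⇒Catching Y-resp LY = dne λ ¬catching →
      escapes⇒¬Large Y-resp (λ n → ¬Catching⇒Escape (¬catching ∘ (n ,_))) LY

    Large⇒Extension : {Y : Pred A ℓy} → Y Respects _≈_ → Large Y a 0 → Extension Y a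
    Large⇒Extension {a = a} {Y = Y} Y-resp LY with Large⇒Catching Y-resp LY
    ... | n , catching with Large-pigeonhole W-resp n (+-identityʳ n) LY-past-n catch
      where
      W-resp : ∀ {y} → (λ x → (Y ∩ (x ∙_) ⊢ Y) y) Respects _≈_
      W-resp x≈ (y , xy) = y , Y-resp (∙-congʳ x≈) xy

      LY-past-n : Large (FS a n ∩ Y) a n
      LY-past-n b σ = let (v , v∈ , y) = LY b (SumSubsystem-weaken z≤n σ)
                      in v , v∈ , transfer-FS σ v∈ , y

      catch : FS a n ∩ Y ⊆ λ y → ∃ λ x → FSIn a 0 n x × (Y ∩ (x ∙_) ⊢ Y) y
      catch (y∈ , y) = let (x , x∈ , xy) = catching y∈ in x , x∈ , y , xy
    ... | x , x∈ , b , σ , large = record { x∈ = x∈ ; rest≼a = σ ; large = large }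

    module Iteration {ℓy} (P : Pred A ℓy → Pred A ℓy)
      (step : ∀ {Z : Pred A ℓy} → Z Respects _≈_ → ∀ {d} → Large Z d 0 →
              Σ (Extension Z d) (P Z ∘ Extension.x))
      {Y : Pred A ℓy} (Y-resp : Y Respects _≈_) {a : Sequence} (LY : Large Y a 0) where

      record Stage : Set (c ⊔ ℓ ⊔ lsuc ℓy) where
        field
          Z      : Pred A ℓy
          Z-resp : Z Respects _≈_
          {past} : ℕ
          base   : Sequence
          base≼a : SumSubsystem base a past
          large  : Large Z base 0

        extension : Σ (Extension Z base) (P Z ∘ Extension.x)
        extension = step Z-resp large

      open Stage

      next : Stage → Stage
      next s = record
        { Z      = Z s ∩ (x ∙_) ⊢ Z s
        ; Z-resp = λ y≈ (z , xz) → Z-resp s y≈ z , Z-resp s (∙-congˡ y≈) xz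
        ; base   = rest
        ; base≼a = SumSubsystem-∘ (base≼a s) rest≼a
        ; large  = Extension.large (proj₁ (extension s))
        }
        where open Extension (proj₁ (extension s))

      stage : ℕ → Stage
      stage zero = record
        { Z = Y ; Z-resp = Y-resp ; base = a ; base≼a = SumSubsystem-tail a 0 ; large = LY }
      stage (suc j) = next (stage j)

      E : Sequence
      E j = Extension.x (proj₁ (extension (stage j)))

      E-prop : ∀ j → P (Z (stage j)) (E j)
      E-prop j = proj₂ (extension (stage j))

      E≼a : SumSubsystem E a 0
      E≼a = record
        { cut   = λ j → past (stage j)
        ; start = z≤n
        ; block = λ j → let s = stage j in
            FSIn-widen (start (base≼a s)) ≤-refl
              (transfer (base≼a s) (Extension.x∈ (proj₁ (extension s))))
        }

      invariant : ∀ j → Z (stage j) ⊆ λ y → Y y × ∀ {u} → FSIn E 0 j u → Y (u ∙ y)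
      invariant zero y = y , λ u∈ → ⊥-elim (<-irrefl ≡.refl (FSIn-nonempty u∈))
      invariant (suc j) (z , ez) =
        let (y , u∙y) = invariant j z
            (ey , u∙ey) = invariant j ez
        in y , λ u∈ → invariant-step u∈ u∙y ey u∙ey
        where
        invariant-step : ∀ {u y} → FSIn E 0 (suc j) u → (∀ {w} → FSIn E 0 j w → Y (w ∙ y)) →
          Y (E j ∙ y) → (∀ {w} → FSIn E 0 j w → Y (w ∙ (E j ∙ y))) → Y (u ∙ y)
        invariant-step u∈ w∙y ey w∙ey with lastView u∈
        ... | unused u∈′ = w∙y u∈′
        ... | alone u≈ = Y-resp (∙-congʳ (sym u≈)) ey
        ... | trailing w∈ u≈ = Y-resp (trans (sym (assoc _ _ _)) (∙-congʳ (sym u≈))) (w∙ey w∈)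

      FS-E⊆Y : (∀ j → Z (stage j) (E j)) → ∀ {J v} → FSIn E 0 J v → Y v
      FS-E⊆Y E∈Z {zero} v∈ = ⊥-elim (<-irrefl ≡.refl (FSIn-nonempty v∈))
      FS-E⊆Y E∈Z {suc J} v∈ with lastView v∈
      ... | unused v∈′ = FS-E⊆Y E∈Z v∈′
      ... | alone v≈ = Y-resp (sym v≈) (proj₁ (invariant J (E∈Z J)))
      ... | trailing u∈ v≈ = Y-resp (sym v≈) (proj₂ (invariant J (E∈Z J)) u∈)

    module _ {Y : Pred A ℓy} (Y-resp : Y Respects _≈_) {a : Sequence} (LY : Large Y a 0) where
      open Iteration (λ _ _ → ⊤) (λ Z-resp LZ → Large⇒Extension Z-resp LZ , tt) Y-resp LY

      invariant-at : ∀ J {v} → FSIn E 0 J v → Stage.Z (stage J) ⊆ Y ∩ (v ∙_) ⊢ Y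
      invariant-at J v∈ z = let (y , u∙y) = invariant J z in y , u∙y v∈

      Large⇒Extension∈ : Σ (Extension Y a) (Y ∘ Extension.x)
      Large⇒Extension∈ =
        let (v , (J , v∈) , y) = LY E E≼a
            open Stage (stage J)
        in record
          { width  = past
          ; x∈     = transfer E≼a v∈
          ; rest≼a = base≼a
          ; large  = Large-mono (invariant-at J v∈) large
          } , y

    module _ {Y : Pred A ℓy} (Y-resp : Y Respects _≈_) {a : Sequence} (LY : Large Y a 0) where
      open Iteration (λ Z x → Z x) Large⇒Extension∈ Y-resp LY

      hindman : ∃ λ b → SumSubsystem b a 0 × FS b 0 ⊆ Y
      hindman = E , E≼a , λ (_ , v∈) → FS-E⊆Y E-prop v∈

    hindman-partition : {X : Pred A ℓx} → X Respects _≈_ → ∀ a →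
      ∃ λ b → SumSubsystem b a 0 × (FS b 0 ⊆ X ⊎ FS b 0 ⊆ ∁ X)
    hindman-partition {X = X} X-resp a with em {P = Large X a 0}
    ... | yes LX = let (b , σ , FS⊆X) = hindman X-resp LX in b , σ , inj₁ FS⊆X
    ... | no ¬LX = let (b , σ , FS⊆∁X) = ¬Large⇒Avoiding ¬LX in b , σ , inj₂ FS⊆∁X

module OrderlyTerms {m ℓm} (V : Module F₂ m ℓm) where
  open Module V
  open FiniteSums +ᴹ-semigroup
    using (FSIn; single; cons; FS; FSIn-nonempty; FSIn-resp; SumSubsystem)
  open SumSubsystem

  sumᴹ : ∀ {k} → Vec Carrierᴹ k → Carrierᴹ
  sumᴹ [] = 0ᴹ
  sumᴹ (x ∷ xs) = x +ᴹ sumᴹ xs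

  sumᴹ-take-drop : ∀ k {l} (xs : Vec Carrierᴹ (k + l)) →
    sumᴹ (take k xs) +ᴹ sumᴹ (drop k xs) ≈ᴹ sumᴹ xs
  sumᴹ-take-drop zero xs = +ᴹ-identityˡ _
  sumᴹ-take-drop (suc k) (x ∷ xs) =
    ≈ᴹ-trans (+ᴹ-assoc _ _ _) (+ᴹ-cong ≈ᴹ-refl (sumᴹ-take-drop k xs))

  ⟦⟧≈sumᴹ : ∀ {k} (t : OT V k) xs → ⟦ V ⟧ t xs ≈ᴹ sumᴹ xs
  ⟦⟧≈sumᴹ var (x ∷ []) = ≈ᴹ-sym (+ᴹ-identityʳ x)
  ⟦⟧≈sumᴹ (add {k} t u) xs =
    ≈ᴹ-trans (+ᴹ-cong (⟦⟧≈sumᴹ t (take k xs)) (⟦⟧≈sumᴹ u (drop k xs))) (sumᴹ-take-drop k xs)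
  ⟦⟧≈sumᴹ (scale true _ t) xs = ≈ᴹ-trans (*ₗ-identityˡ _) (⟦⟧≈sumᴹ t xs)
  ⟦⟧≈sumᴹ (scale false false≢false t) xs = ⊥-elim (false≢false ≡.refl)

  OT-arity-nonzero : ∀ {k} → OT V k → k ≢ 0
  OT-arity-nonzero var ()
  OT-arity-nonzero (add t u) k+l≡0 = OT-arity-nonzero t (m+n≡0⇒m≡0 _ k+l≡0)
  OT-arity-nonzero (scale _ _ t) = OT-arity-nonzero t

  FS-sumᴹ : ∀ (a : Seq V) {k p i} {I : Vec ℕ k} → p ≤ i → Increasing V (i ∷ I) →
    FS a p (sumᴹ (map a (i ∷ I)))
  FS-sumᴹ a {I = []} p≤i _ = _ , single p≤i (n<1+n _) (+ᴹ-identityʳ _)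
  FS-sumᴹ a {I = _ ∷ _} p≤i (i<j ∷ increasing) =
    let (q , w) = FS-sumᴹ a i<j increasing in q , cons p≤i w ≈ᴹ-refl

  FR⊆FS : ∀ (a : Seq V) {k} (t : OT V k) (I : Vec ℕ k) → Increasing V I →
    FS a 0 (⟦ V ⟧ t (map a I))
  FR⊆FS a t [] _ = ⊥-elim (OT-arity-nonzero t ≡.refl)
  FR⊆FS a t (i ∷ I) increasing =
    let (q , w) = FS-sumᴹ a z≤n increasing in q , FSIn-resp (≈ᴹ-sym (⟦⟧≈sumᴹ t _)) w

  record OrderlyRepresentation (b : Seq V) (p q : ℕ) (v : Carrierᴹ) : Set (m ⊔ ℓm) where
    field
      {arity}    : ℕ
      term       : OT V arity
      indices    : Vec ℕ arity
      increasing : Increasing V indices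
      within     : All (λ i → p ≤ i × i < q) indices
      value      : v ≈ᴹ ⟦ V ⟧ term (map b indices)

  represent : ∀ {b p q v} → FSIn b p q v → OrderlyRepresentation b p q v
  represent (single {i = i} p≤i i<q v≈) = record
    { term = var ; indices = i ∷ [] ; increasing = [-] ; within = (p≤i , i<q) ∷ [] ; value = v≈ }
  represent {q = q} (cons {i = i} p≤i w v≈) = record
    { term       = add var term
    ; indices    = i ∷ indices
    ; increasing = prepend increasing within
    ; within     = (p≤i , <-trans (n<1+n i) (FSIn-nonempty w))
                 ∷ All.map (λ (i<j , j<q) → ≤-trans p≤i (<⇒≤ i<j) , j<q) within
    ; value      = ≈ᴹ-trans v≈ (+ᴹ-cong ≈ᴹ-refl value)
    }
    where
    open OrderlyRepresentation (represent w)
    prepend : ∀ {k} {I : Vec ℕ k} → Increasing V I → All (λ j → suc i ≤ j × j < q) I →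
      Increasing V (i ∷ I)
    prepend {I = []} _ _ = [-]
    prepend {I = _ ∷ _} increasing ((i<j , _) ∷ _) = i<j ∷ increasing

  SumSubsystem⇒≤K : ∀ {a b} → SumSubsystem a b 0 → _≤K_ V a b
  SumSubsystem⇒≤K {a} {b} σ =
    arity ∘ rep , term ∘ rep , indices ∘ rep , increasing ∘ rep , before , value ∘ rep
    where
    open OrderlyRepresentation
    rep : ∀ j → OrderlyRepresentation b (cut σ j) (cut σ (suc j)) (a j)
    rep j = represent (block σ j)
    before : ∀ j → Before V (indices (rep j)) (indices (rep (suc j)))
    before j = All.map (λ (_ , i<cut) → All.map (λ (cut≤k , _) → <-≤-trans i<cut cut≤k)
                                                 (within (rep (suc j))))
                       (within (rep j))

open FiniteSums.Classical using (hindman-partition)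
open OrderlyTerms using (FR⊆FS; SumSubsystem⇒≤K)

theorem7p5 : (∀ {ℓ} → ExcludedMiddle ℓ) →
    ∀ {m ℓm} (V : Module F₂ m ℓm) → IsRamseyAlgebra V
theorem7p5 em V b X X-resp with hindman-partition (Module.+ᴹ-semigroup V) em X-resp b
... | a , σ , inj₁ FS⊆X  = a , SumSubsystem⇒≤K V σ , inj₁ λ t I inc → FS⊆X (FR⊆FS V a t I inc)
... | a , σ , inj₂ FS⊆∁X = a , SumSubsystem⇒≤K V σ , inj₂ λ t I inc → FS⊆∁X (FR⊆FS V a t I inc)
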